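{- Let $G$ be a graph and $v$ a vertex of $G$. If $G$ is isomorphic to $C_4$, then there is a map $f:V(G)\to[5]^2$ such that every vertex of $G$ other than $v$ is satisfied and $\left|\bigcup_{u\in N[v]} f(u)\right|\ge3$. If $G$ is isomorphic to $C_7$, $C_4\cdot C_4$ or $K_{2,3}$, then there is a map $f:V(G)\to[5]^2$ such that every vertex of $G$ other than $v$ is satisfied and $\left|\bigcup_{u\in N[v]} f(u)\right|\ge4$.
   Context: $C_n$ is the cycle on $n$ vertices; $C_4\cdot C_4$ is the graph obtained from two disjoint $4$-cycles by identifying a vertex of the first with a vertex of the second. $[5]^2$ is the set of $2$-element subsets of $\{1,2,3,4,5\}$. For $f:V(G)\to[5]^2$, a vertex $w$ is satisfied if $\bigcup_{u\in N[w]} f(u)=\{1,2,3,4,5\}$, where $N[w]$ is the closed neighborhood of $w$. -}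

module Defs where

open import Data.Nat using (ℕ; zero; suc; _≡ᵇ_)
open import Data.Bool using (Bool; true; false; _∨_; _∧_; if_then_else_)
open import Data.Bool.Properties using (∨-comm)
open import Data.Fin using (Fin; zero; suc; toℕ)
open import Data.Fin.Subset using (Subset; _∪_; ⊥; ⊤; ∣_∣)
open import Data.List using (List; []; _∷_; foldr)
open import Data.Bool.ListAction using (any)
open import Data.List using (allFin)
open import Data.Product using (Σ; _×_; _,_)
open import Function.Definitions using (Bijective)
open import Relation.Binary.PropositionalEquality using (_≡_; refl)

record Graph (n : ℕ) : Set where
  field
    Adj   : Fin n → Fin n → Bool
    sym   : ∀ u w → Adj u w ≡ Adj w u
    irrefl : ∀ u → Adj u u ≡ false
open Graph public

record _≅_ {n m : ℕ} (G : Graph n) (H : Graph m) : Set where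
  field
    to        : Fin n → Fin m
    bijective : Bijective _≡_ _≡_ to
    preserves : ∀ u w → Adj G u w ≡ Adj H (to u) (to w)

Pair5 : Set
Pair5 = Σ (Subset 5) (λ s → ∣ s ∣ ≡ 2)

colours : Pair5 → Subset 5
colours (s , _) = s

inN : ∀ {n} → Graph n → Fin n → Fin n → Bool
inN G w u = (toℕ u ≡ᵇ toℕ w) ∨ Adj G w u

NUnion : ∀ {n} → (G : Graph n) → (Fin n → Pair5) → Fin n → Subset 5
NUnion {n} G f w = foldr (λ u acc → (if inN G w u then colours (f u) else ⊥) ∪ acc) ⊥ (allFin n)

Satisfied : ∀ {n} → (G : Graph n) → (Fin n → Pair5) → Fin n → Set
Satisfied G f w = NUnion G f w ≡ ⊤

edgeIn : ∀ {n} → List (ℕ × ℕ) → Fin n → Fin n → Bool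
edgeIn es u w = any (λ { (a , b) → (toℕ u ≡ᵇ a) ∧ (toℕ w ≡ᵇ b) }) es

adjOf : ∀ {n} → List (ℕ × ℕ) → Fin n → Fin n → Bool
adjOf es u w = edgeIn es u w ∨ edgeIn es w u

adjOf-sym : ∀ {n} (es : List (ℕ × ℕ)) (u w : Fin n) → adjOf es u w ≡ adjOf es w u
adjOf-sym es u w = ∨-comm (edgeIn es u w) (edgeIn es w u)

C4-edges : List (ℕ × ℕ)
C4-edges = (0 , 1) ∷ (1 , 2) ∷ (2 , 3) ∷ (3 , 0) ∷ []

C4 : Graph 4
C4 = record { Adj = adjOf C4-edges ; sym = adjOf-sym C4-edges ; irrefl = irr }
  where
  irr : ∀ u → adjOf C4-edges u u ≡ false
  irr zero = refl
  irr (suc zero) = refl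
  irr (suc (suc zero)) = refl
  irr (suc (suc (suc zero))) = refl

C7-edges : List (ℕ × ℕ)
C7-edges = (0 , 1) ∷ (1 , 2) ∷ (2 , 3) ∷ (3 , 4) ∷ (4 , 5) ∷ (5 , 6) ∷ (6 , 0) ∷ []

irr7 : (es : List (ℕ × ℕ)) → Set
irr7 es = ∀ (u : Fin 7) → adjOf es u u ≡ false

C7 : Graph 7
C7 = record { Adj = adjOf C7-edges ; sym = adjOf-sym C7-edges ; irrefl = irr }
  where
  irr : irr7 C7-edges
  irr zero = refl
  irr (suc zero) = refl
  irr (suc (suc zero)) = refl
  irr (suc (suc (suc zero))) = refl
  irr (suc (suc (suc (suc zero)))) = refl
  irr (suc (suc (suc (suc (suc zero))))) = refl
  irr (suc (suc (suc (suc (suc (suc zero)))))) = refl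

-- C4·C4 : two 4-cycles 0-1-2-3-0 and 0-4-5-6-0 sharing vertex 0
C4C4-edges : List (ℕ × ℕ)
C4C4-edges = (0 , 1) ∷ (1 , 2) ∷ (2 , 3) ∷ (3 , 0) ∷ (0 , 4) ∷ (4 , 5) ∷ (5 , 6) ∷ (6 , 0) ∷ []

C4·C4 : Graph 7
C4·C4 = record { Adj = adjOf C4C4-edges ; sym = adjOf-sym C4C4-edges ; irrefl = irr }
  where
  irr : irr7 C4C4-edges
  irr zero = refl
  irr (suc zero) = refl
  irr (suc (suc zero)) = refl
  irr (suc (suc (suc zero))) = refl
  irr (suc (suc (suc (suc zero)))) = refl
  irr (suc (suc (suc (suc (suc zero))))) = refl
  irr (suc (suc (suc (suc (suc (suc zero)))))) = refl

K23-edges : List (ℕ × ℕ)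
K23-edges = (0 , 2) ∷ (0 , 3) ∷ (0 , 4) ∷ (1 , 2) ∷ (1 , 3) ∷ (1 , 4) ∷ []

K23 : Graph 5
K23 = record { Adj = adjOf K23-edges ; sym = adjOf-sym K23-edges ; irrefl = irr }
  where
  irr : ∀ (u : Fin 5) → adjOf K23-edges u u ≡ false
  irr zero = refl
  irr (suc zero) = refl
  irr (suc (suc zero)) = refl
  irr (suc (suc (suc zero))) = refl
  irr (suc (suc (suc (suc zero)))) = refl

-- The four graphs are small, so for each graph and each choice of the exceptional vertex v an
-- explicit labelling is exhibited and verified by evaluation. Satisfaction is invariant under
-- graph isomorphism, which transports these labellings to any G isomorphic to one of the graphs.
module Submission where

open import Defs
open import Data.Bool using (_∨_; if_then_else_)
import Data.Bool.Properties as Bool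
open import Data.Empty using (⊥-elim)
open import Data.Fin using (Fin; toℕ; #_)
open import Data.Fin.Properties using (toℕ-injective; all?; _≟_)
open import Data.Fin.Subset using (Subset; _∪_; ⊥; ⊤; ⁅_⁆; ∣_∣; _∈_; _⊆_)
open import Data.Fin.Subset.Properties using (x∈p∪q⁻; p⊆p∪q; q⊆p∪q; ∉⊥; ⊆-antisym)
open import Data.List using (List; []; _∷_; foldr; allFin)
open import Data.List.Membership.Propositional using () renaming (_∈_ to _∈ₗ_)
open import Data.List.Membership.Propositional.Properties using (∈-allFin)
open import Data.List.Relation.Unary.Any using (here; there)
open import Data.Nat using (ℕ; _≤_; _≤?_; _≡ᵇ_)
import Data.Nat.Properties as ℕ
open import Data.Product using (Σ; _×_; _,_; ∃; proj₁; proj₂)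
open import Data.Sum using (_⊎_; inj₁; inj₂)
open import Data.Vec using (Vec; []; _∷_; lookup)
open import Data.Vec.Properties using (≡-dec)
open import Function using (_∘_)
open import Function.Bundles using (mk⇔)
open import Function.Definitions using (Injective; Surjective)
open import Relation.Nullary.Decidable using (Dec; True; toWitness; does-⇔; ¬?; _×-dec_; _→-dec_)
open import Relation.Unary using (Decidable)
open import Relation.Binary.PropositionalEquality as ≡ using (_≡_; _≢_; refl; cong; cong₂; subst)

⋃[_]_ : ∀ {a} {A : Set a} {k} → (A → Subset k) → List A → Subset k
⋃[ F ] xs = foldr (λ x acc → F x ∪ acc) ⊥ xs

module _ {a} {A : Set a} {k} (F : A → Subset k) where

  ∈-⋃⁻ : ∀ xs {i} → i ∈ ⋃[ F ] xs → ∃ λ x → i ∈ F x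
  ∈-⋃⁻ []       i∈ = ⊥-elim (∉⊥ i∈)
  ∈-⋃⁻ (x ∷ xs) i∈ with x∈p∪q⁻ (F x) (⋃[ F ] xs) i∈
  ... | inj₁ i∈Fx = x , i∈Fx
  ... | inj₂ i∈⋃  = ∈-⋃⁻ xs i∈⋃

  ∈-⋃⁺ : ∀ {xs x i} → x ∈ₗ xs → i ∈ F x → i ∈ ⋃[ F ] xs
  ∈-⋃⁺ {_ ∷ xs} (here refl) i∈ = p⊆p∪q (⋃[ F ] xs) i∈
  ∈-⋃⁺ {y ∷ xs} (there x∈)  i∈ = q⊆p∪q (F y) (⋃[ F ] xs) (∈-⋃⁺ x∈ i∈)

⋃-allFin-reindex : ∀ {k n m} {G : Fin n → Subset k} {F : Fin m → Subset k} (f : Fin n → Fin m) →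
  Surjective _≡_ _≡_ f → (∀ u → G u ≡ F (f u)) → ⋃[ G ] allFin n ≡ ⋃[ F ] allFin m
⋃-allFin-reindex {G = G} {F} f surj G≗F∘f = ⊆-antisym ⊆-image ⊇-image
  where
  ⊆-image : ⋃[ G ] allFin _ ⊆ ⋃[ F ] allFin _
  ⊆-image i∈ with ∈-⋃⁻ G (allFin _) i∈
  ... | u , i∈Gu = ∈-⋃⁺ F (∈-allFin (f u)) (subst (_ ∈_) (G≗F∘f u) i∈Gu)
  ⊇-image : ⋃[ F ] allFin _ ⊆ ⋃[ G ] allFin _
  ⊇-image i∈ with ∈-⋃⁻ F (allFin _) i∈
  ... | y , i∈Fy with surj y
  ... | u , fu≡y = ∈-⋃⁺ G (∈-allFin u) (subst (_ ∈_) Fy≡Gu i∈Fy)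
    where Fy≡Gu = ≡.sym (≡.trans (G≗F∘f u) (cong F (fu≡y refl)))

≡ᵇ-toℕ-injective : ∀ {n m} {f : Fin n → Fin m} → Injective _≡_ _≡_ f →
  ∀ u w → (toℕ (f u) ≡ᵇ toℕ (f w)) ≡ (toℕ u ≡ᵇ toℕ w)
≡ᵇ-toℕ-injective {f = f} f-inj u w =
  does-⇔ (mk⇔ (cong toℕ ∘ f-inj ∘ toℕ-injective) (cong (toℕ ∘ f) ∘ toℕ-injective))
         (toℕ (f u) ℕ.≟ toℕ (f w)) (toℕ u ℕ.≟ toℕ w)

SatisfiedExcept : ∀ {n} → Graph n → (Fin n → Pair5) → Fin n → Set
SatisfiedExcept G f v = ∀ w → w ≢ v → Satisfied G f w

IsLabellingExcept : ∀ {n} → Graph n → Fin n → ℕ → (Fin n → Pair5) → Set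
IsLabellingExcept G v b f = SatisfiedExcept G f v × b ≤ ∣ NUnion G f v ∣

LabellingExcept : ∀ {n} → Graph n → Fin n → ℕ → Set
LabellingExcept G v b = Σ _ (IsLabellingExcept G v b)

module _ {n m} {G : Graph n} {H : Graph m} (G≅H : G ≅ H) where
  open _≅_ G≅H

  inN-≅ : ∀ w u → inN H (to w) (to u) ≡ inN G w u
  inN-≅ w u = cong₂ _∨_ (≡ᵇ-toℕ-injective (proj₁ bijective) u w) (≡.sym (preserves w u))

  NUnion-≅ : ∀ (f : Fin m → Pair5) w → NUnion G (f ∘ to) w ≡ NUnion H f (to w)
  NUnion-≅ f w = ⋃-allFin-reindex to (proj₂ bijective)
    (λ u → cong (λ b → if b then colours (f (to u)) else ⊥) (≡.sym (inN-≅ w u)))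

  LabellingExcept-≅ : ∀ {v b} → LabellingExcept H (to v) b → LabellingExcept G v b
  LabellingExcept-≅ {v} {b} (f , satisfied , bound) =
    f ∘ to ,
    (λ w w≢v → ≡.trans (NUnion-≅ f w) (satisfied (to w) (w≢v ∘ proj₁ bijective))) ,
    subst (λ s → b ≤ ∣ s ∣) (≡.sym (NUnion-≅ f v)) bound

isLabellingExcept? : ∀ {n} (G : Graph n) v b f → Dec (IsLabellingExcept G v b f)
isLabellingExcept? G v b f = all? (λ w → ¬? (w ≟ v) →-dec satisfied? w) ×-dec (b ≤? ∣ NUnion G f v ∣)
  where
  satisfied? : Decidable (Satisfied G f)
  satisfied? w = ≡-dec Bool._≟_ (NUnion G f w) ⊤

-- Row v of the table is the labelling for the exceptional vertex v; the implicit argument is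
-- discharged by evaluating the decision procedure on the concrete table.
labellingsExcept-fromTable : ∀ {n} (G : Graph n) b (table : Vec (Vec Pair5 n) n) →
  {True (all? λ v → isLabellingExcept? G v b (lookup (lookup table v)))} →
  ∀ v → LabellingExcept G v b
labellingsExcept-fromTable G b table {valid} v = lookup (lookup table v) , toWitness valid v

pair : (i j : Fin 5) → {True (∣ ⁅ i ⁆ ∪ ⁅ j ⁆ ∣ ℕ.≟ 2)} → Pair5
pair i j {distinct} = ⁅ i ⁆ ∪ ⁅ j ⁆ , toWitness distinct

c01 c02 c03 c04 c12 c13 c14 c23 c24 c34 : Pair5
c01 = pair (# 0) (# 1)
c02 = pair (# 0) (# 2)
c03 = pair (# 0) (# 3)
c04 = pair (# 0) (# 4)
c12 = pair (# 1) (# 2)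
c13 = pair (# 1) (# 3)
c14 = pair (# 1) (# 4)
c23 = pair (# 2) (# 3)
c24 = pair (# 2) (# 4)
c34 = pair (# 3) (# 4)

C4-labellingsExcept : ∀ v → LabellingExcept C4 v 3
C4-labellingsExcept = labellingsExcept-fromTable C4 3
  ( (c01 ∷ c02 ∷ c34 ∷ c12 ∷ []) ∷
    (c01 ∷ c02 ∷ c12 ∷ c34 ∷ []) ∷
    (c01 ∷ c23 ∷ c24 ∷ c34 ∷ []) ∷
    (c01 ∷ c23 ∷ c04 ∷ c14 ∷ []) ∷ [])

C7-labellingsExcept : ∀ v → LabellingExcept C7 v 4
C7-labellingsExcept = labellingsExcept-fromTable C7 4
  ( (c01 ∷ c02 ∷ c34 ∷ c12 ∷ c01 ∷ c34 ∷ c23 ∷ []) ∷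
    (c01 ∷ c02 ∷ c13 ∷ c24 ∷ c01 ∷ c23 ∷ c34 ∷ []) ∷
    (c01 ∷ c02 ∷ c34 ∷ c23 ∷ c01 ∷ c24 ∷ c34 ∷ []) ∷
    (c01 ∷ c02 ∷ c34 ∷ c13 ∷ c01 ∷ c24 ∷ c34 ∷ []) ∷
    (c01 ∷ c02 ∷ c34 ∷ c12 ∷ c01 ∷ c23 ∷ c34 ∷ []) ∷
    (c01 ∷ c02 ∷ c34 ∷ c12 ∷ c03 ∷ c24 ∷ c34 ∷ []) ∷
    (c01 ∷ c02 ∷ c34 ∷ c13 ∷ c02 ∷ c14 ∷ c34 ∷ []) ∷ [])

C4·C4-labellingsExcept : ∀ v → LabellingExcept C4·C4 v 4
C4·C4-labellingsExcept = labellingsExcept-fromTable C4·C4 4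
  ( (c01 ∷ c02 ∷ c34 ∷ c12 ∷ c03 ∷ c24 ∷ c13 ∷ []) ∷
    (c01 ∷ c01 ∷ c23 ∷ c24 ∷ c03 ∷ c24 ∷ c13 ∷ []) ∷
    (c01 ∷ c02 ∷ c34 ∷ c23 ∷ c04 ∷ c23 ∷ c14 ∷ []) ∷
    (c01 ∷ c02 ∷ c34 ∷ c13 ∷ c04 ∷ c23 ∷ c14 ∷ []) ∷
    (c01 ∷ c02 ∷ c34 ∷ c12 ∷ c01 ∷ c23 ∷ c34 ∷ []) ∷
    (c01 ∷ c02 ∷ c34 ∷ c12 ∷ c03 ∷ c24 ∷ c34 ∷ []) ∷
    (c01 ∷ c02 ∷ c34 ∷ c12 ∷ c03 ∷ c24 ∷ c14 ∷ []) ∷ [])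

K23-labellingsExcept : ∀ v → LabellingExcept K23 v 4
K23-labellingsExcept = labellingsExcept-fromTable K23 4
  ( (c01 ∷ c23 ∷ c04 ∷ c14 ∷ c24 ∷ []) ∷
    (c01 ∷ c23 ∷ c04 ∷ c24 ∷ c34 ∷ []) ∷
    (c01 ∷ c23 ∷ c01 ∷ c24 ∷ c34 ∷ []) ∷
    (c01 ∷ c23 ∷ c04 ∷ c12 ∷ c34 ∷ []) ∷
    (c01 ∷ c23 ∷ c04 ∷ c14 ∷ c23 ∷ []) ∷ [])

lemma3p3 : ∀ {n : ℕ} (G : Graph n) (v : Fin n) →
    (G ≅ C4 → Σ (Fin n → Pair5) (λ f →
        (∀ w → w ≢ v → Satisfied G f w) × 3 ≤ ∣ NUnion G f v ∣))
    × ((G ≅ C7 ⊎ (G ≅ C4·C4 ⊎ G ≅ K23)) → Σ (Fin n → Pair5) (λ f →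
        (∀ w → w ≢ v → Satisfied G f w) × 4 ≤ ∣ NUnion G f v ∣))
lemma3p3 G v =
  (λ G≅C4 → transfer G≅C4 C4-labellingsExcept) ,
  λ { (inj₁ G≅C7)             → transfer G≅C7 C7-labellingsExcept
    ; (inj₂ (inj₁ G≅C4·C4)) → transfer G≅C4·C4 C4·C4-labellingsExcept
    ; (inj₂ (inj₂ G≅K23))   → transfer G≅K23 K23-labellingsExcept
    }
  where
  transfer : ∀ {m b} {H : Graph m} (G≅H : G ≅ H) → (∀ v′ → LabellingExcept H v′ b) → LabellingExcept G v b
  transfer G≅H labellings = LabellingExcept-≅ G≅H (labellings (_≅_.to G≅H v))
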